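{- For all $n\ge 0$ and $0\le k\le n$, the number of rooks $r\in R_n$ whose union of cycle supports has cardinality $k$ equals the number of rooks $r\in R_n$ with $\mathrm{PZ}(r)=k$.
   Context: A rook of size $n$ is a word $r=r_1\dots r_n$ over $\{0,1,\dots,n\}$ whose nonzero letters are pairwise distinct; $R_n$ is the set of these. A rook is viewed as an injective partial map of $\{1,\dots,n\}$ with $r(i)=r_i$ if $r_i\ne 0$ and $r(i)$ undefined otherwise. An element $i$ belongs to a cycle of $r$ if $r^m(i)=i$ for some $m\ge 1$; the union of the cycle supports is the set of all such $i$. For $r\in R_n$, $\mathrm{PZ}(r)=\min\{j: r_j=0\}-1$ if $r$ contains a $0$, and $\mathrm{PZ}(r)=n$ otherwise. -}

module Defs where

open import Data.Nat using (ℕ; zero; suc; _≤_; _≟_)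
open import Data.Fin using (Fin; zero; suc)
open import Data.Fin.Properties using (all?; any?) renaming (_≟_ to _≟ᶠ_)
open import Data.Vec using (Vec; []; _∷_; lookup)
open import Data.List using (List; []; _∷_; concatMap; map; filter; length; allFin)
open import Data.Maybe using (Maybe; just; nothing; _>>=_)
open import Data.Product using (Σ; _×_; _,_)
open import Relation.Nullary using (Dec; ¬_; _→-dec_; _×-dec_; ¬?)
open import Relation.Binary.PropositionalEquality using (_≡_)
open import Data.Maybe.Properties using (≡-dec)

-- A word of length n over {0,1,...,n}: letter 0 is encoded by 'zero : Fin (suc n)',
-- letter j+1 by 'suc j' (j : Fin n).
Word : ℕ → Set
Word n = Vec (Fin (suc n)) n

allWords : {A : Set} → List A → (m : ℕ) → List (Vec A m)
allWords as zero = [] ∷ []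
allWords as (suc m) = concatMap (λ a → map (a ∷_) (allWords as m)) as

IsRook : {n : ℕ} → Word n → Set
IsRook {n} r = (i j : Fin n) → ¬ (i ≡ j) → ¬ (lookup r i ≡ zero) → ¬ (lookup r i ≡ lookup r j)

isRook? : {n : ℕ} → (r : Word n) → Dec (IsRook r)
isRook? {n} r = all? λ i → all? λ j →
  ¬? (i ≟ᶠ j) →-dec (¬? (lookup r i ≟ᶠ zero) →-dec ¬? (lookup r i ≟ᶠ lookup r j))

-- R_n, as an explicit list (each rook occurs exactly once)
rooks : (n : ℕ) → List (Word n)
rooks n = filter isRook? (allWords (allFin (suc n)) n)

-- the rook as a partial map of {1..n} (positions/values shifted to Fin n)
apply : {n : ℕ} → Word n → Fin n → Maybe (Fin n)
apply r i with lookup r i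
... | zero = nothing
... | suc j = just j

iter : {n : ℕ} → Word n → ℕ → Fin n → Maybe (Fin n)
iter r zero i = just i
iter r (suc m) i = iter r m i >>= apply r

-- i lies on a cycle: r^m(i) = i for some m ≥ 1.  The search is bounded by n,
-- which loses nothing (a minimal such m is at most n).
InCycle : {n : ℕ} → Word n → Fin n → Set
InCycle {n} r i = Σ (Fin n) λ m → iter r (suc (Data.Fin.toℕ m)) i ≡ just i

inCycle? : {n : ℕ} → (r : Word n) → (i : Fin n) → Dec (InCycle r i)
inCycle? {n} r i = any? λ m → ≡-dec _≟ᶠ_ (iter r (suc (Data.Fin.toℕ m)) i) (just i)

cycSupportSize : {n : ℕ} → Word n → ℕ
cycSupportSize {n} r = length (filter (inCycle? r) (allFin n))

-- PZ(r) = (position of the first 0) - 1, or n if there is no 0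
PZ : {n m : ℕ} → Vec (Fin (suc n)) m → ℕ
PZ [] = 0
PZ (zero ∷ v) = 0
PZ (suc _ ∷ v) = suc (PZ v)

countCyc : (n k : ℕ) → ℕ
countCyc n k = length (filter (λ r → cycSupportSize r ≟ k) (rooks n))

countPZ : (n k : ℕ) → ℕ
countPZ n k = length (filter (λ r → PZ r ≟ k) (rooks n))

module Submission where

-- Both statistics partition R_n, so their counts have the same sum over
-- 0 ≤ k ≤ n; it therefore suffices that both satisfy
-- count(n+1, k+1) = (n+1) · count(n, k), which then also settles k = 0.
-- For PZ: a rook with PZ = k+1 begins with a nonzero letter v+1, and deleting
-- it (closing the gap v+1 in the alphabet) leaves a rook of size n with PZ = k.
-- For the cycle support, count pairs (r, p) with p on a cycle of r in two ways.
-- Swapping the values of r at p and at x = r(p) makes x a fixed point without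
-- changing the cycle support, and the same swap undoes this; hence
-- (k+1) · #{r : |cyc r| = k+1} = (k+1) · #{(r, x) : |cyc r| = k+1, r(x) = x}.
-- Deleting a fixed point x (position x and letter x+1) leaves a rook of size n
-- whose cycle support has size k.  Cycle membership is handled through the
-- condition that the forward orbit is everywhere defined: for rooks it is
-- equivalent by the pigeonhole principle, and it is easy to transport along swaps.

open import Defs
open import Data.Bool using (true; false; if_then_else_)
open import Data.Fin using (Fin; zero; suc; punchIn; punchOut; toℕ; fromℕ<)
open import Data.Fin.Permutation.Components using (transpose)
open import Data.Fin.Properties
  using (pigeonhole; toℕ<n; toℕ-fromℕ<; punchInᵢ≢i; punchIn-injective; punchIn-punchOut; punchOut-punchIn; punchOut-cong)
  renaming (_≟_ to _≟ᶠ_)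
open import Data.List using (List; []; _∷_; map; concatMap; _++_; length; filter; allFin)
open import Data.List.Membership.Propositional using (_∈_)
open import Data.List.Membership.Propositional.Properties
  using (∈-map⁺; ∈-map⁻; ∈-++⁺ˡ; ∈-++⁺ʳ; ∈-++⁻; ∈-filter⁺; ∈-filter⁻; ∈-allFin)
open import Data.List.Membership.Propositional.Properties.WithK using (unique∧set⇒bag)
open import Data.List.Properties using (length-map; length-++; map-++)
import Data.List.Properties as List
open import Data.List.Relation.Binary.BagAndSetEquality using (∼bag⇒↭)
open import Data.List.Relation.Binary.Permutation.Propositional.Properties using (↭-length)
open import Data.List.Relation.Unary.All using (All; []; _∷_)
import Data.List.Relation.Unary.All as All
open import Data.List.Relation.Unary.AllPairs using ([]; _∷_)
open import Data.List.Relation.Unary.Any using (here; there)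
open import Data.List.Relation.Unary.Unique.Propositional using (Unique)
import Data.List.Relation.Unary.Unique.Propositional.Properties as Unique
open import Data.Maybe using (Maybe; just; nothing; _>>=_)
import Data.Maybe as Maybe
open import Data.Maybe.Properties using (just-injective; map-just)
open import Data.Nat using (ℕ; zero; suc; _+_; _*_; _≤_; _<_; z≤n; s≤s; _≡ᵇ_) renaming (_≟_ to _≟ℕ_)
open import Data.Nat.Properties
  using (+-commutativeSemigroup; suc-injective; *-cancelʳ-≡; +-cancelʳ-≡; +-suc; n<1+n;
         m≤n⇒∃[o]m+o≡n; ≤-trans; ≤-pred; m≤n+m)
open import Algebra.Properties.CommutativeSemigroup +-commutativeSemigroup using () renaming (interchange to +-interchange)
open import Data.Product using (∃-syntax; _×_; _,_; proj₁; proj₂)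
open import Data.Sum using (inj₁; inj₂)
open import Data.Vec using (Vec; []; _∷_; lookup; insertAt; removeAt)
import Data.Vec as Vec
open import Data.Vec.Properties
  using (lookup∘tabulate; tabulate-cong; tabulate∘lookup; lookup-map; map-∘; map-cong; map-id;
         insertAt-lookup; insertAt-punchIn; removeAt-punchOut; removeAt-insertAt; insertAt-removeAt)
open import Function.Base using (_∘_; id)
open import Function.Bundles using (_⇔_; mk⇔; Equivalence)
open import Relation.Binary.PropositionalEquality
open import Relation.Nullary using (Dec; ¬_; yes; no; contradiction)
open import Relation.Nullary.Decidable using (dec-true; dec-false)

private
  variable
    A B : Set
    m n : ℕ
    xs : List A
    ys : List B

-- Counting elements of duplicate-free lists

sigmaList : List A → (A → List B) → List (A × B)
sigmaList []       f = []
sigmaList (a ∷ as) f = map (a ,_) (f a) ++ sigmaList as f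

module _ {f : A → List B} {a : A} {b : B} where

  ∈-sigmaList⁺ : a ∈ xs → b ∈ f a → (a , b) ∈ sigmaList xs f
  ∈-sigmaList⁺ {xs = a ∷ _} (here refl) b∈ = ∈-++⁺ˡ (∈-map⁺ (a ,_) b∈)
  ∈-sigmaList⁺ {xs = c ∷ _} (there a∈) b∈ = ∈-++⁺ʳ (map (c ,_) (f c)) (∈-sigmaList⁺ a∈ b∈)

  ∈-sigmaList⁻ : (a , b) ∈ sigmaList xs f → a ∈ xs × b ∈ f a
  ∈-sigmaList⁻ {xs = c ∷ _} p with ∈-++⁻ (map (c ,_) (f c)) p
  ... | inj₁ q with ∈-map⁻ (c ,_) q
  ...   | _ , b∈ , refl = here refl , b∈
  ∈-sigmaList⁻ {xs = c ∷ _} p | inj₂ q with ∈-sigmaList⁻ q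
  ...   | a∈ , b∈ = there a∈ , b∈

sigmaList-unique : {f : A → List B} → Unique xs → (∀ a → Unique (f a)) → Unique (sigmaList xs f)
sigmaList-unique {xs = []} _ _ = []
sigmaList-unique {xs = a ∷ as} {f} (a∉ ∷ u) uf =
  Unique.++⁺ (Unique.map⁺ (cong proj₂) (uf a)) (sigmaList-unique u uf) disjoint
  where
  disjoint : ∀ {v} → ¬ (v ∈ map (a ,_) (f a) × v ∈ sigmaList as f)
  disjoint (p , q) with ∈-map⁻ (a ,_) p
  ... | _ , _ , refl = Unique.Unique[x∷xs]⇒x∉xs (a∉ ∷ u) (proj₁ (∈-sigmaList⁻ q))

length-sigmaList : (xs : List A) (f : A → List B) (c : ℕ) → (∀ {a} → a ∈ xs → length (f a) ≡ c) →
  length (sigmaList xs f) ≡ length xs * c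
length-sigmaList []       f c h = refl
length-sigmaList (a ∷ as) f c h = begin
  length (map (a ,_) (f a) ++ sigmaList as f)         ≡⟨ length-++ (map (a ,_) (f a)) ⟩
  length (map (a ,_) (f a)) + length (sigmaList as f) ≡⟨ cong₂ _+_ (trans (length-map (a ,_) (f a)) (h (here refl)))
                                                                    (length-sigmaList as f c (h ∘ there)) ⟩
  c + length as * c                                   ∎
  where open ≡-Reasoning

map-unique : (f : A → B) → Unique xs → (∀ {x y} → x ∈ xs → y ∈ xs → f x ≡ f y → x ≡ y) →
  Unique (map f xs)
map-unique {xs = []}     f _         _   = []
map-unique {xs = x ∷ xs} f (x∉ ∷ u) inj =
  All-map x∉ (λ y∈ → y∈) ∷ map-unique f u (λ p q → inj (there p) (there q))
  where
  All-map : {zs : List _} → All (λ y → ¬ x ≡ y) zs → (∀ {y} → y ∈ zs → y ∈ xs) →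
    All (λ z → ¬ f x ≡ z) (map f zs)
  All-map []         _  = []
  All-map (x≢y ∷ ps) ⊆xs = (x≢y ∘ inj (here refl) (there (⊆xs (here refl)))) ∷ All-map ps (⊆xs ∘ there)

length-≡-sameElements : {xs ys : List A} → Unique xs → Unique ys → (∀ {z} → z ∈ xs ⇔ z ∈ ys) →
  length xs ≡ length ys
length-≡-sameElements ux uy same = ↭-length (∼bag⇒↭ (unique∧set⇒bag ux uy same))

length-≡-inverses : (f : A → B) (g : B → A) → Unique xs → Unique ys →
  (∀ {x} → x ∈ xs → f x ∈ ys) → (∀ {y} → y ∈ ys → g y ∈ xs) →
  (∀ {x} → x ∈ xs → g (f x) ≡ x) → (∀ {y} → y ∈ ys → f (g y) ≡ y) → length xs ≡ length ys
length-≡-inverses {xs = xs} {ys = ys} f g ux uy f∈ g∈ gf fg =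
  trans (sym (length-map f xs)) (length-≡-sameElements fxs-unique uy (mk⇔ to from))
  where
  fxs-unique : Unique (map f xs)
  fxs-unique = map-unique f ux (λ p q e → trans (sym (gf p)) (trans (cong g e) (gf q)))
  to : ∀ {y} → y ∈ map f xs → y ∈ ys
  to p with ∈-map⁻ f p
  ... | _ , x∈ , refl = f∈ x∈
  from : ∀ {y} → y ∈ ys → y ∈ map f xs
  from y∈ = subst (_∈ map f xs) (fg y∈) (∈-map⁺ f (g∈ y∈))

length-allFin : ∀ n → length (allFin n) ≡ n
length-allFin n = List.length-tabulate id

data PunchInView (p : Fin (suc n)) : Fin (suc n) → Set where
  at      : PunchInView p p
  punched : (i : Fin n) → PunchInView p (punchIn p i)

punchInView : (p j : Fin (suc n)) → PunchInView p j
punchInView p j with p ≟ᶠ j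
... | yes refl = at
... | no  p≢j  = subst (PunchInView p) (punchIn-punchOut p≢j) (punched (punchOut p≢j))

length-filter-punchIn : {P : Fin (suc n) → Set} {Q : Fin n → Set} (P? : ∀ j → Dec (P j)) (Q? : ∀ i → Dec (Q i))
  (p : Fin (suc n)) → P p → (∀ i → P (punchIn p i) ⇔ Q i) →
  length (filter P? (allFin (suc n))) ≡ suc (length (filter Q? (allFin n)))
length-filter-punchIn {n = n} P? Q? p Pp P⇔Q = begin
  length (filter P? (allFin (suc n))) ≡⟨ length-≡-sameElements (Unique.filter⁺ P? (Unique.allFin⁺ _)) pQs-unique (mk⇔ to from) ⟩
  length pQs                          ≡⟨ cong suc (length-map (punchIn p) Qs) ⟩
  suc (length Qs)                     ∎
  where
  open ≡-Reasoning
  Qs : List (Fin n)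
  Qs = filter Q? (allFin n)
  pQs : List (Fin (suc n))
  pQs = p ∷ map (punchIn p) Qs
  pQs-unique : Unique pQs
  pQs-unique = All.tabulate p∉ ∷ Unique.map⁺ (punchIn-injective p _ _) (Unique.filter⁺ Q? (Unique.allFin⁺ n))
    where
    p∉ : ∀ {j} → j ∈ map (punchIn p) Qs → p ≢ j
    p∉ j∈ with ∈-map⁻ (punchIn p) j∈
    ... | i , _ , refl = punchInᵢ≢i p i ∘ sym
  to : ∀ {j} → j ∈ filter P? (allFin (suc n)) → j ∈ pQs
  to {j} j∈ with punchInView p j | proj₂ (∈-filter⁻ P? {xs = allFin (suc n)} j∈)
  ... | at        | _  = here refl
  ... | punched i | Pj = there (∈-map⁺ (punchIn p) (∈-filter⁺ Q? (∈-allFin i) (Equivalence.to (P⇔Q i) Pj)))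
  from : ∀ {j} → j ∈ pQs → j ∈ filter P? (allFin (suc n))
  from (here refl) = ∈-filter⁺ P? (∈-allFin p) Pp
  from (there j∈) with ∈-map⁻ (punchIn p) j∈
  ... | i , i∈ , refl = ∈-filter⁺ P? (∈-allFin _) (Equivalence.from (P⇔Q i) (proj₂ (∈-filter⁻ Q? {xs = allFin n} i∈)))

-- Sums of fibre sizes

sumUpTo : (ℕ → ℕ) → ℕ → ℕ
sumUpTo f zero    = f zero
sumUpTo f (suc n) = f zero + sumUpTo (f ∘ suc) n

sumUpTo-cong : ∀ {f g} n → (∀ k → k ≤ n → f k ≡ g k) → sumUpTo f n ≡ sumUpTo g n
sumUpTo-cong zero    f≡g = f≡g zero z≤n
sumUpTo-cong (suc n) f≡g = cong₂ _+_ (f≡g zero z≤n) (sumUpTo-cong n (λ k k≤n → f≡g (suc k) (s≤s k≤n)))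

sumUpTo-+ : ∀ f g n → sumUpTo (λ k → f k + g k) n ≡ sumUpTo f n + sumUpTo g n
sumUpTo-+ f g zero    = refl
sumUpTo-+ f g (suc n) = begin
  (f 0 + g 0) + sumUpTo (λ k → f (suc k) + g (suc k)) n     ≡⟨ cong ((f 0 + g 0) +_) (sumUpTo-+ (f ∘ suc) (g ∘ suc) n) ⟩
  (f 0 + g 0) + (sumUpTo (f ∘ suc) n + sumUpTo (g ∘ suc) n) ≡⟨ +-interchange (f 0) (g 0) _ _ ⟩
  (f 0 + sumUpTo (f ∘ suc) n) + (g 0 + sumUpTo (g ∘ suc) n) ∎
  where open ≡-Reasoning

sumUpTo-zero : ∀ n → sumUpTo (λ _ → 0) n ≡ 0
sumUpTo-zero zero    = refl
sumUpTo-zero (suc n) = sumUpTo-zero n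

indicator : ℕ → ℕ → ℕ
indicator a k = if a ≡ᵇ k then 1 else 0

sumUpTo-indicator : ∀ a n → a ≤ n → sumUpTo (indicator a) n ≡ 1
sumUpTo-indicator zero    zero    _         = refl
sumUpTo-indicator zero    (suc n) _         = cong suc (sumUpTo-zero n)
sumUpTo-indicator (suc a) (suc n) (s≤s a≤n) = sumUpTo-indicator a n a≤n

fibre : (A → ℕ) → List A → ℕ → List A
fibre g xs k = filter (λ x → g x ≟ℕ k) xs

fibreSize : (A → ℕ) → List A → ℕ → ℕ
fibreSize g xs k = length (fibre g xs k)

module _ {g : A → ℕ} {k : ℕ} where

  fibre-unique : Unique xs → Unique (fibre g xs k)
  fibre-unique = Unique.filter⁺ (λ x → g x ≟ℕ k)

  ∈-fibre⁺ : ∀ {x} → x ∈ xs → g x ≡ k → x ∈ fibre g xs k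
  ∈-fibre⁺ = ∈-filter⁺ (λ x → g x ≟ℕ k)

  ∈-fibre⁻ : ∀ {x} → x ∈ fibre g xs k → x ∈ xs × g x ≡ k
  ∈-fibre⁻ = ∈-filter⁻ (λ x → g x ≟ℕ k)

-- ℕ's _≟_ decides by _≡ᵇ_, so abstracting over g x ≡ᵇ k computes both sides.
fibreSize-∷ : ∀ (g : A → ℕ) x xs k → fibreSize g (x ∷ xs) k ≡ indicator (g x) k + fibreSize g xs k
fibreSize-∷ g x xs k with g x ≡ᵇ k
... | true  = refl
... | false = refl

sumUpTo-fibreSize : (g : A → ℕ) (n : ℕ) → (∀ x → g x ≤ n) → ∀ xs → sumUpTo (fibreSize g xs) n ≡ length xs
sumUpTo-fibreSize g n g≤n [] = sumUpTo-zero n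
sumUpTo-fibreSize g n g≤n (x ∷ xs) = begin
  sumUpTo (fibreSize g (x ∷ xs)) n                         ≡⟨ sumUpTo-cong n (λ k _ → fibreSize-∷ g x xs k) ⟩
  sumUpTo (λ k → indicator (g x) k + fibreSize g xs k) n   ≡⟨ sumUpTo-+ (indicator (g x)) (fibreSize g xs) n ⟩
  sumUpTo (indicator (g x)) n + sumUpTo (fibreSize g xs) n ≡⟨ cong₂ _+_ (sumUpTo-indicator (g x) n (g≤n x))
                                                                         (sumUpTo-fibreSize g n g≤n xs) ⟩
  suc (length xs)                                          ∎
  where open ≡-Reasoning

sumUpTo-head : ∀ f g n → sumUpTo f (suc n) ≡ sumUpTo g (suc n) → (∀ k → k ≤ n → f (suc k) ≡ g (suc k)) → f 0 ≡ g 0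
sumUpTo-head f g n sums tails = +-cancelʳ-≡ (sumUpTo (g ∘ suc) n) (f 0) (g 0)
  (trans (cong (f 0 +_) (sym (sumUpTo-cong n tails))) sums)

allWords-sigmaList : {A : Set} (as : List A) (m : ℕ) →
  allWords as (suc m) ≡ map (λ (a , w) → a ∷ w) (sigmaList as (λ _ → allWords as m))
allWords-sigmaList {A} as m = prepend-sigmaList as
  where
  open ≡-Reasoning
  W : List (Vec A m)
  W = allWords as m
  cons : A × Vec A m → Vec A (suc m)
  cons (a , w) = a ∷ w
  prepend-sigmaList : ∀ bs → concatMap (λ b → map (b ∷_) W) bs ≡ map cons (sigmaList bs (λ _ → W))
  prepend-sigmaList []       = refl
  prepend-sigmaList (b ∷ bs) = begin
    map (b ∷_) W ++ concatMap (λ b → map (b ∷_) W) bs            ≡⟨ cong₂ _++_ (List.map-∘ W) (prepend-sigmaList bs) ⟩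
    map cons (map (b ,_) W) ++ map cons (sigmaList bs (λ _ → W)) ≡⟨ map-++ cons (map (b ,_) W) _ ⟨
    map cons (map (b ,_) W ++ sigmaList bs (λ _ → W))            ∎

∈-allWords : {as : List A} → (∀ a → a ∈ as) → ∀ m (w : Vec A m) → w ∈ allWords as m
∈-allWords all∈ zero    []      = here refl
∈-allWords {as = as} all∈ (suc m) (a ∷ w) =
  subst ((a ∷ w) ∈_) (sym (allWords-sigmaList as m))
    (∈-map⁺ _ (∈-sigmaList⁺ (all∈ a) (∈-allWords all∈ m w)))

allWords-unique : {as : List A} → Unique as → ∀ m → Unique (allWords as m)
allWords-unique u zero    = [] ∷ []
allWords-unique {as = as} u (suc m) =
  subst Unique (sym (allWords-sigmaList as m))
    (Unique.map⁺ (λ { refl → refl }) (sigmaList-unique u (λ _ → allWords-unique u m)))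

rooks-unique : ∀ n → Unique (rooks n)
rooks-unique n = Unique.filter⁺ isRook? (allWords-unique (Unique.allFin⁺ (suc n)) n)

LetterInjective : Word n → Set
LetterInjective {n} r = ∀ i j → lookup r i ≡ lookup r j → lookup r i ≢ zero → i ≡ j

isRook⇒letterInjective : {r : Word n} → IsRook r → LetterInjective r
isRook⇒letterInjective rook i j rᵢ≡rⱼ rᵢ≢0 with i ≟ᶠ j
... | yes i≡j = i≡j
... | no  i≢j = contradiction rᵢ≡rⱼ (rook i j i≢j rᵢ≢0)

letterInjective⇒isRook : {r : Word n} → LetterInjective r → IsRook r
letterInjective⇒isRook inj i j i≢j rᵢ≢0 rᵢ≡rⱼ = i≢j (inj i j rᵢ≡rⱼ rᵢ≢0)

module _ {g : Word n → ℕ} {k : ℕ} {r : Word n} where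

  ∈-rookFibre⁺ : LetterInjective r → g r ≡ k → r ∈ fibre g (rooks n) k
  ∈-rookFibre⁺ inj =
    ∈-fibre⁺ (∈-filter⁺ isRook? (∈-allWords ∈-allFin n r) (letterInjective⇒isRook {r = r} inj))

  ∈-rookFibre⁻ : r ∈ fibre g (rooks n) k → LetterInjective r × g r ≡ k
  ∈-rookFibre⁻ r∈ with ∈-fibre⁻ r∈
  ... | r∈rooks , gr≡k =
    isRook⇒letterInjective {r = r} (proj₂ (∈-filter⁻ isRook? {xs = allWords (allFin (suc n)) n} r∈rooks)) , gr≡k

rookFibre-unique : (g : Word n → ℕ) (k : ℕ) → Unique (fibre g (rooks n) k)
rookFibre-unique g k = fibre-unique (rooks-unique _)

-- Inserting and deleting a letter

-- The inverse of punchIn (suc v), sending the deleted letter suc v to the junk value 0.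
deleteLetter : Fin (suc n) → Fin (suc (suc n)) → Fin (suc n)
deleteLetter v a with suc v ≟ᶠ a
... | yes _   = zero
... | no  v≢a = punchOut v≢a

deleteLetter-punchIn : ∀ (v : Fin (suc n)) a → deleteLetter v (punchIn (suc v) a) ≡ a
deleteLetter-punchIn v a with suc v ≟ᶠ punchIn (suc v) a
... | yes v≡a = contradiction (sym v≡a) (punchInᵢ≢i (suc v) a)
... | no  v≢a = trans (punchOut-cong (suc v) {i≢j = v≢a} refl) (punchOut-punchIn (suc v))

punchIn-deleteLetter : ∀ (v : Fin (suc n)) {a} → a ≢ suc v → punchIn (suc v) (deleteLetter v a) ≡ a
punchIn-deleteLetter v {a} a≢v with suc v ≟ᶠ a
... | yes v≡a = contradiction (sym v≡a) a≢v
... | no  v≢a = punchIn-punchOut v≢a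

map-fixes : (f : A → A) (xs : Vec A m) → (∀ i → f (lookup xs i) ≡ lookup xs i) → Vec.map f xs ≡ xs
map-fixes f []       _      = refl
map-fixes f (x ∷ xs) fixes = cong₂ _∷_ (fixes zero) (map-fixes f xs (fixes ∘ suc))

lookup-removeAt : (xs : Vec A (suc m)) (p : Fin (suc m)) (i : Fin m) →
  lookup (removeAt xs p) i ≡ lookup xs (punchIn p i)
lookup-removeAt xs p i =
  trans (cong (lookup (removeAt xs p)) (sym (punchOut-punchIn p))) (removeAt-punchOut xs (punchInᵢ≢i p i ∘ sym))

insertLetter : Fin (suc n) → Fin (suc n) → Word n → Word (suc n)
insertLetter p v r = insertAt (Vec.map (punchIn (suc v)) r) p (suc v)

removeLetter : Fin (suc n) → Fin (suc n) → Word (suc n) → Word n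
removeLetter p v r = Vec.map (deleteLetter v) (removeAt r p)

module _ (p v : Fin (suc n)) where

  lookup-insertLetter-at : (r : Word n) → lookup (insertLetter p v r) p ≡ suc v
  lookup-insertLetter-at r = insertAt-lookup _ p (suc v)

  lookup-insertLetter-punchIn : (r : Word n) (i : Fin n) →
    lookup (insertLetter p v r) (punchIn p i) ≡ punchIn (suc v) (lookup r i)
  lookup-insertLetter-punchIn r i = trans (insertAt-punchIn _ p (suc v) i) (lookup-map i _ r)

  lookup-insertLetter-punchIn≢ : (r : Word n) (i : Fin n) → lookup (insertLetter p v r) (punchIn p i) ≢ suc v
  lookup-insertLetter-punchIn≢ r i e = punchInᵢ≢i (suc v) (lookup r i) (trans (sym (lookup-insertLetter-punchIn r i)) e)

  lookup-removeLetter : (r : Word (suc n)) (i : Fin n) →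
    lookup (removeLetter p v r) i ≡ deleteLetter v (lookup r (punchIn p i))
  lookup-removeLetter r i = trans (lookup-map i _ (removeAt r p)) (cong (deleteLetter v) (lookup-removeAt r p i))

  removeLetter-insertLetter : (r : Word n) → removeLetter p v (insertLetter p v r) ≡ r
  removeLetter-insertLetter r = begin
    Vec.map (deleteLetter v) (removeAt (insertAt (Vec.map (punchIn (suc v)) r) p (suc v)) p)
      ≡⟨ cong (Vec.map (deleteLetter v)) (removeAt-insertAt _ p (suc v)) ⟩
    Vec.map (deleteLetter v) (Vec.map (punchIn (suc v)) r) ≡⟨ map-∘ _ _ r ⟨
    Vec.map (deleteLetter v ∘ punchIn (suc v)) r           ≡⟨ map-cong (deleteLetter-punchIn v) r ⟩
    Vec.map id r                                           ≡⟨ map-id r ⟩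
    r                                                      ∎
    where open ≡-Reasoning

  module _ {r : Word (suc n)} (inj : LetterInjective r) (rₚ≡v : lookup r p ≡ suc v) where

    letter≢removed : ∀ i → lookup r (punchIn p i) ≢ suc v
    letter≢removed i e = punchInᵢ≢i p i (inj _ _ (trans e (sym rₚ≡v)) λ e′ → contradiction (trans (sym e) e′) λ ())

    insertLetter-removeLetter : insertLetter p v (removeLetter p v r) ≡ r
    insertLetter-removeLetter = begin
      insertAt (Vec.map (punchIn (suc v)) (Vec.map (deleteLetter v) (removeAt r p))) p (suc v)
        ≡⟨ cong (λ t → insertAt t p (suc v)) (trans (sym (map-∘ _ _ _)) (map-fixes _ _ reinsert)) ⟩
      insertAt (removeAt r p) p (suc v)      ≡⟨ cong (insertAt (removeAt r p) p) rₚ≡v ⟨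
      insertAt (removeAt r p) p (lookup r p) ≡⟨ insertAt-removeAt r p ⟩
      r                                      ∎
      where
      open ≡-Reasoning
      reinsert : ∀ i → punchIn (suc v) (deleteLetter v (lookup (removeAt r p) i)) ≡ lookup (removeAt r p) i
      reinsert i rewrite lookup-removeAt r p i = punchIn-deleteLetter v (letter≢removed i)

    removeLetter-letterInjective : LetterInjective (removeLetter p v r)
    removeLetter-letterInjective i j eq nz = punchIn-injective p i j (inj _ _ same nonzero)
      where
      same : lookup r (punchIn p i) ≡ lookup r (punchIn p j)
      same = begin
        lookup r (punchIn p i)                                    ≡⟨ punchIn-deleteLetter v (letter≢removed i) ⟨
        punchIn (suc v) (deleteLetter v (lookup r (punchIn p i))) ≡⟨ cong (punchIn (suc v))
           (trans (sym (lookup-removeLetter r i)) (trans eq (lookup-removeLetter r j))) ⟩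
        punchIn (suc v) (deleteLetter v (lookup r (punchIn p j))) ≡⟨ punchIn-deleteLetter v (letter≢removed j) ⟩
        lookup r (punchIn p j)                                    ∎
        where open ≡-Reasoning
      nonzero : lookup r (punchIn p i) ≢ zero
      nonzero e = nz (trans (lookup-removeLetter r i) (cong (deleteLetter v) e))

  insertLetter-letterInjective : {r : Word n} → LetterInjective r → LetterInjective (insertLetter p v r)
  insertLetter-letterInjective {r} inj i j eq nz with punchInView p i | punchInView p j
  ... | at        | at        = refl
  ... | at        | punched j = contradiction (sym (trans (sym (lookup-insertLetter-at r)) eq)) (lookup-insertLetter-punchIn≢ r j)
  ... | punched i | at        = contradiction (trans eq (lookup-insertLetter-at r)) (lookup-insertLetter-punchIn≢ r i)
  ... | punched i | punched j = cong (punchIn p) (inj i j same nonzero)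
    where
    same : lookup r i ≡ lookup r j
    same = punchIn-injective (suc v) _ _
      (trans (sym (lookup-insertLetter-punchIn r i)) (trans eq (lookup-insertLetter-punchIn r j)))
    nonzero : lookup r i ≢ zero
    nonzero e = nz (trans (lookup-insertLetter-punchIn r i) (cong (punchIn (suc v)) e))

-- The statistic PZ

-- r(i), with the junk value i where r is undefined.
image : Word n → Fin n → Fin n
image r i with lookup r i
... | zero  = i
... | suc j = j

lookup≡suc⇒image : (r : Word n) {i j : Fin n} → lookup r i ≡ suc j → image r i ≡ j
lookup≡suc⇒image r {i} rᵢ≡j with lookup r i
lookup≡suc⇒image r refl | suc j = refl

PZ-map-punchIn : ∀ (v : Fin (suc n)) (t : Vec (Fin (suc n)) m) → PZ (Vec.map (punchIn (suc v)) t) ≡ PZ t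
PZ-map-punchIn v []        = refl
PZ-map-punchIn v (zero ∷ t)  = refl
PZ-map-punchIn v (suc a ∷ t) = cong suc (PZ-map-punchIn v t)

PZ-insertLetter-zero : ∀ (v : Fin (suc n)) (r : Word n) → PZ (insertLetter zero v r) ≡ suc (PZ r)
PZ-insertLetter-zero v r = cong suc (PZ-map-punchIn v r)

PZ≡suc⇒head : ∀ {k} (r : Word (suc n)) → PZ r ≡ suc k → lookup r zero ≡ suc (image r zero)
PZ≡suc⇒head (suc v ∷ t) _ = refl

module _ (n k : ℕ) where

  private
    headRemoved : Word (suc n) → Fin (suc n) × Word n
    headRemoved r = image r zero , removeLetter zero (image r zero) r

    headInserted : Fin (suc n) × Word n → Word (suc n)
    headInserted (v , r) = insertLetter zero v r

    Smaller : List (Fin (suc n) × Word n)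
    Smaller = sigmaList (allFin (suc n)) (λ _ → fibre PZ (rooks n) k)

    headRemoved∈ : ∀ {r} → r ∈ fibre PZ (rooks (suc n)) (suc k) → headRemoved r ∈ Smaller
    headRemoved∈ {r} r∈ with ∈-rookFibre⁻ r∈
    ... | inj , PZr≡k = ∈-sigmaList⁺ (∈-allFin v) (∈-rookFibre⁺ (removeLetter-letterInjective zero v {r} inj r₀≡v) PZ≡k)
      where
      v : Fin (suc n)
      v = image r zero
      r₀≡v : lookup r zero ≡ suc v
      r₀≡v = PZ≡suc⇒head r PZr≡k
      PZ≡k : PZ (removeLetter zero v r) ≡ k
      PZ≡k = suc-injective (begin
        suc (PZ (removeLetter zero v r))                 ≡⟨ PZ-insertLetter-zero v _ ⟨
        PZ (insertLetter zero v (removeLetter zero v r)) ≡⟨ cong PZ (insertLetter-removeLetter zero v {r} inj r₀≡v) ⟩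
        PZ r                                             ≡⟨ PZr≡k ⟩
        suc k                                            ∎)
        where open ≡-Reasoning

    headInserted-headRemoved : ∀ {r} → r ∈ fibre PZ (rooks (suc n)) (suc k) → headInserted (headRemoved r) ≡ r
    headInserted-headRemoved {r} r∈ = let (inj , PZr≡k) = ∈-rookFibre⁻ r∈ in
      insertLetter-removeLetter zero _ {r} inj (PZ≡suc⇒head r PZr≡k)

    headInserted∈ : ∀ {vr} → vr ∈ Smaller → headInserted vr ∈ fibre PZ (rooks (suc n)) (suc k)
    headInserted∈ {v , r} vr∈ with ∈-rookFibre⁻ (proj₂ (∈-sigmaList⁻ {xs = allFin (suc n)} vr∈))
    ... | inj , PZr≡k =
      ∈-rookFibre⁺ (insertLetter-letterInjective zero v {r} inj) (trans (PZ-insertLetter-zero v r) (cong suc PZr≡k))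

  countPZ-suc : countPZ (suc n) (suc k) ≡ suc n * countPZ n k
  countPZ-suc = begin
    countPZ (suc n) (suc k)               ≡⟨ length-≡-inverses headRemoved headInserted
                                             (rookFibre-unique PZ (suc k))
                                             (sigmaList-unique (Unique.allFin⁺ (suc n)) (λ _ → rookFibre-unique PZ k))
                                             headRemoved∈ headInserted∈ headInserted-headRemoved
                                             (λ { {v , r} _ → cong (v ,_) (removeLetter-insertLetter zero v r) }) ⟩
    length Smaller                        ≡⟨ length-sigmaList (allFin (suc n)) (λ _ → fibre PZ (rooks n) k)
                                                              (countPZ n k) (λ _ → refl) ⟩
    length (allFin (suc n)) * countPZ n k ≡⟨ cong (_* countPZ n k) (length-allFin (suc n)) ⟩
    suc n * countPZ n k                   ∎
    where open ≡-Reasoning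

-- Cycles and everywhere defined orbits

unsuc : Fin (suc n) → Maybe (Fin n)
unsuc zero    = nothing
unsuc (suc j) = just j

apply≡unsuc∘lookup : (r : Word n) (i : Fin n) → apply r i ≡ unsuc (lookup r i)
apply≡unsuc∘lookup r i with lookup r i
... | zero  = refl
... | suc _ = refl

apply≡just⇒lookup : (r : Word n) {i j : Fin n} → apply r i ≡ just j → lookup r i ≡ suc j
apply≡just⇒lookup r {i} e with lookup r i
apply≡just⇒lookup r refl | suc j = refl

lookup≡suc⇒apply : (r : Word n) {i j : Fin n} → lookup r i ≡ suc j → apply r i ≡ just j
lookup≡suc⇒apply r e = trans (apply≡unsuc∘lookup r _) (cong unsuc e)

apply-injective : (r : Word n) → LetterInjective r → ∀ {i i′ j} → apply r i ≡ just j → apply r i′ ≡ just j → i ≡ i′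
apply-injective r inj rᵢ≡j rᵢ′≡j =
  inj _ _ (trans (apply≡just⇒lookup r rᵢ≡j) (sym (apply≡just⇒lookup r rᵢ′≡j)))
    λ rᵢ≡0 → contradiction (trans (sym (apply≡just⇒lookup r rᵢ≡j)) rᵢ≡0) λ ()

InfiniteOrbit : Word n → Fin n → Set
InfiniteOrbit {n} r i = ∀ m → ∃[ z ] iter r m i ≡ just z

module _ (r : Word n) where

  iter-suc-head : ∀ {z w} → apply r z ≡ just w → ∀ m → iter r (suc m) z ≡ iter r m w
  iter-suc-head rz≡w zero    = rz≡w
  iter-suc-head rz≡w (suc m) = cong (_>>= apply r) (iter-suc-head rz≡w m)

  iter-suc-nothing : ∀ {z} → apply r z ≡ nothing → ∀ m → iter r (suc m) z ≡ nothing
  iter-suc-nothing rz≡∅ zero    = rz≡∅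
  iter-suc-nothing rz≡∅ (suc m) = cong (_>>= apply r) (iter-suc-nothing rz≡∅ m)

  infiniteOrbit-step : ∀ {i} → InfiniteOrbit r i → ∃[ z ] apply r i ≡ just z × InfiniteOrbit r z
  infiniteOrbit-step orbit with orbit 1
  ... | z , rᵢ≡z = z , rᵢ≡z , λ m → subst (λ y → ∃[ w ] y ≡ just w) (iter-suc-head rᵢ≡z m) (orbit (suc m))

  infiniteOrbit-closed : (Q : Fin n → Set) → (∀ {z} → Q z → ∃[ w ] apply r z ≡ just w × Q w) →
    ∀ {i} → Q i → InfiniteOrbit r i
  infiniteOrbit-closed Q closed {i} qᵢ m = let (z , iₘ≡z , _) = reach m in z , iₘ≡z
    where
    reach : ∀ m → ∃[ z ] iter r m i ≡ just z × Q z
    reach zero    = i , refl , qᵢ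
    reach (suc m) with reach m
    ... | z , iₘ≡z , q with closed q
    ...   | w , rz≡w , q′ = w , trans (cong (_>>= apply r) iₘ≡z) rz≡w , q′

  fixed⇒infiniteOrbit : ∀ {x} → apply r x ≡ just x → InfiniteOrbit r x
  fixed⇒infiniteOrbit {x} rx≡x = infiniteOrbit-closed (_≡ x) (λ { refl → x , rx≡x , refl }) refl

  returns⇒infiniteOrbit : ∀ {i} j → iter r (suc j) i ≡ just i → InfiniteOrbit r i
  returns⇒infiniteOrbit {i} period returns = infiniteOrbit-closed Returns closed (period , returns)
    where
    Returns : Fin n → Set
    Returns z = ∃[ j ] iter r (suc j) z ≡ just i
    closed : ∀ {z} → Returns z → ∃[ w ] apply r z ≡ just w × Returns w
    closed {z} (j , zⱼ≡i) with apply r z in rz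
    ... | nothing = contradiction (trans (sym (iter-suc-nothing rz j)) zⱼ≡i) λ ()
    ... | just w with j | trans (sym (iter-suc-head rz j)) zⱼ≡i
    ...   | zero  | w≡i = w , refl , subst Returns (sym (just-injective w≡i)) (period , returns)
    ...   | suc j | wⱼ≡i = w , refl , j , wⱼ≡i

  inCycle⇒infiniteOrbit : ∀ {i} → InCycle r i → InfiniteOrbit r i
  inCycle⇒infiniteOrbit (m , returns) = returns⇒infiniteOrbit (toℕ m) returns

  module _ (inj : LetterInjective r) where

    iter-cancel : ∀ {i z} a {d} → iter r a i ≡ just z → iter r (a + d) i ≡ just z → iter r d i ≡ just i
    iter-cancel zero refl returns = returns
    iter-cancel {i} (suc a) {d} rᵃ⁺¹≡z rᵃ⁺ᵈ⁺¹≡z with iter r a i in rᵃ | iter r (a + d) i in rᵃ⁺ᵈ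
    ... | just u | just u′ =
      iter-cancel a rᵃ (trans rᵃ⁺ᵈ (cong just (sym (apply-injective r inj rᵃ⁺¹≡z rᵃ⁺ᵈ⁺¹≡z))))

    infiniteOrbit⇒inCycle : ∀ {i} → InfiniteOrbit r i → InCycle r i
    infiniteOrbit⇒inCycle {i} orbit with pigeonhole (n<1+n n) (λ j → proj₁ (orbit (toℕ j)))
    ... | j₁ , j₂ , j₁<j₂ , same with m≤n⇒∃[o]m+o≡n j₁<j₂
    ...   | e , 1+j₁+e≡j₂ = fromℕ< e<n , subst (λ d → iter r (suc d) i ≡ just i) (sym (toℕ-fromℕ< e<n)) returns
      where
      a : ℕ
      a = toℕ j₁
      returns : iter r (suc e) i ≡ just i
      returns = iter-cancel a (proj₂ (orbit a))
        (trans (cong (λ d → iter r d i) (trans (+-suc a e) 1+j₁+e≡j₂))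
          (trans (proj₂ (orbit (toℕ j₂))) (cong just (sym same))))
      e<n : e < n
      e<n = ≤-trans (s≤s (m≤n+m e a)) (subst (_≤ n) (sym 1+j₁+e≡j₂) (≤-pred (toℕ<n j₂)))

apply≡just⇒image : (r : Word n) {i j : Fin n} → apply r i ≡ just j → image r i ≡ j
apply≡just⇒image r = lookup≡suc⇒image r ∘ apply≡just⇒lookup r

inCycle⇒apply≡image : (r : Word n) {i : Fin n} → InCycle r i → apply r i ≡ just (image r i)
inCycle⇒apply≡image r cycle with infiniteOrbit-step r (inCycle⇒infiniteOrbit r cycle)
... | j , rᵢ≡j , _ = trans rᵢ≡j (cong just (sym (apply≡just⇒image r rᵢ≡j)))

map-just⁻ : ∀ {f : A → B} {a : Maybe A} {b} → Maybe.map f a ≡ just b → ∃[ a′ ] a ≡ just a′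
map-just⁻ {a = just a′} _ = a′ , refl

module _ (x : Fin (suc n)) (r : Word n) where

  apply-insertFixed-punchIn : ∀ i → apply (insertLetter x x r) (punchIn x i) ≡ Maybe.map (punchIn x) (apply r i)
  apply-insertFixed-punchIn i = begin
    apply (insertLetter x x r) (punchIn x i)          ≡⟨ apply≡unsuc∘lookup (insertLetter x x r) (punchIn x i) ⟩
    unsuc (lookup (insertLetter x x r) (punchIn x i)) ≡⟨ cong unsuc (lookup-insertLetter-punchIn x x r i) ⟩
    unsuc (punchIn (suc x) (lookup r i))              ≡⟨ unsuc-punchIn (lookup r i) ⟩
    Maybe.map (punchIn x) (unsuc (lookup r i))        ≡⟨ cong (Maybe.map (punchIn x)) (apply≡unsuc∘lookup r i) ⟨
    Maybe.map (punchIn x) (apply r i)                 ∎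
    where
    open ≡-Reasoning
    unsuc-punchIn : ∀ a → unsuc (punchIn (suc x) a) ≡ Maybe.map (punchIn x) (unsuc a)
    unsuc-punchIn zero    = refl
    unsuc-punchIn (suc a) = refl

  iter-insertFixed-punchIn : ∀ m i → iter (insertLetter x x r) m (punchIn x i) ≡ Maybe.map (punchIn x) (iter r m i)
  iter-insertFixed-punchIn zero    i = refl
  iter-insertFixed-punchIn (suc m) i rewrite iter-insertFixed-punchIn m i with iter r m i
  ... | nothing = refl
  ... | just z  = apply-insertFixed-punchIn z

  apply-insertFixed-fixed : apply (insertLetter x x r) x ≡ just x
  apply-insertFixed-fixed = trans (apply≡unsuc∘lookup (insertLetter x x r) x) (cong unsuc (lookup-insertLetter-at x x r))

  infiniteOrbit-insertFixed-punchIn : ∀ i → InfiniteOrbit (insertLetter x x r) (punchIn x i) ⇔ InfiniteOrbit r i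
  infiniteOrbit-insertFixed-punchIn i = mk⇔
    (λ orbit m → map-just⁻ (trans (sym (iter-insertFixed-punchIn m i)) (proj₂ (orbit m))))
    (λ orbit m → punchIn x (proj₁ (orbit m)) , trans (iter-insertFixed-punchIn m i) (map-just (proj₂ (orbit m))))

  cycSupportSize-insertFixed : LetterInjective r → cycSupportSize (insertLetter x x r) ≡ suc (cycSupportSize r)
  cycSupportSize-insertFixed inj =
    length-filter-punchIn (inCycle? (insertLetter x x r)) (inCycle? r) x (zero , apply-insertFixed-fixed) λ i → mk⇔
      (infiniteOrbit⇒inCycle r inj ∘ Equivalence.to (infiniteOrbit-insertFixed-punchIn i) ∘ inCycle⇒infiniteOrbit _)
      (infiniteOrbit⇒inCycle _ (insertLetter-letterInjective x x {r} inj)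
        ∘ Equivalence.from (infiniteOrbit-insertFixed-punchIn i) ∘ inCycle⇒infiniteOrbit r)

-- Swapping two values of a rook

module _ {i j : Fin n} where

  transpose-matchˡ : transpose i j i ≡ j
  transpose-matchˡ rewrite dec-true (i ≟ᶠ i) refl = refl

  transpose-matchʳ : transpose i j j ≡ i
  transpose-matchʳ with j ≟ᶠ i
  ... | yes j≡i = j≡i
  ... | no  _   rewrite dec-true (j ≟ᶠ j) refl = refl

  transpose-other : ∀ {k} → k ≢ i → k ≢ j → transpose i j k ≡ k
  transpose-other {k} k≢i k≢j rewrite dec-false (k ≟ᶠ i) k≢i | dec-false (k ≟ᶠ j) k≢j = refl

  transpose-involutive : ∀ k → transpose i j (transpose i j k) ≡ k
  transpose-involutive k with i ≟ᶠ k | j ≟ᶠ k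
  ... | yes refl | _        = trans (cong (transpose i j) transpose-matchˡ) transpose-matchʳ
  ... | no  _    | yes refl = trans (cong (transpose i j) transpose-matchʳ) transpose-matchˡ
  ... | no  i≢k  | no  j≢k  = trans (cong (transpose i j) (transpose-other k≢i k≢j)) (transpose-other k≢i k≢j)
    where
    k≢i : k ≢ i
    k≢i = i≢k ∘ sym
    k≢j : k ≢ j
    k≢j = j≢k ∘ sym

swap : Word n → Fin n → Fin n → Word n
swap r p x = Vec.tabulate (lookup r ∘ transpose p x)

module _ (r : Word n) (p x : Fin n) where

  private
    τ : Fin n → Fin n
    τ = transpose p x

  lookup-swap : ∀ i → lookup (swap r p x) i ≡ lookup r (τ i)
  lookup-swap = lookup∘tabulate (lookup r ∘ τ)

  swap-involutive : swap (swap r p x) p x ≡ r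
  swap-involutive = trans (tabulate-cong λ i → trans (lookup-swap (τ i)) (cong (lookup r) (transpose-involutive i)))
                          (tabulate∘lookup r)

  swap-letterInjective : LetterInjective r → LetterInjective (swap r p x)
  swap-letterInjective inj i j eq nz = begin
    i         ≡⟨ transpose-involutive i ⟨
    τ (τ i)   ≡⟨ cong τ (inj (τ i) (τ j) (trans (sym (lookup-swap i)) (trans eq (lookup-swap j)))
                                         (nz ∘ trans (lookup-swap i))) ⟩
    τ (τ j)   ≡⟨ transpose-involutive j ⟩
    j         ∎
    where open ≡-Reasoning

  apply-swap : ∀ i → apply (swap r p x) i ≡ apply r (τ i)
  apply-swap i = begin
    apply (swap r p x) i          ≡⟨ apply≡unsuc∘lookup (swap r p x) i ⟩
    unsuc (lookup (swap r p x) i) ≡⟨ cong unsuc (lookup-swap i) ⟩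
    unsuc (lookup r (τ i))        ≡⟨ apply≡unsuc∘lookup r (τ i) ⟨
    apply r (τ i)                 ∎
    where open ≡-Reasoning

  apply-swap-first : apply (swap r p x) p ≡ apply r x
  apply-swap-first = trans (apply-swap p) (cong (apply r) (transpose-matchˡ {i = p} {x}))

  apply-swap-second : apply (swap r p x) x ≡ apply r p
  apply-swap-second = trans (apply-swap x) (cong (apply r) (transpose-matchʳ {i = p} {x}))

  apply-swap-other : ∀ {z} → p ≢ z → x ≢ z → apply (swap r p x) z ≡ apply r z
  apply-swap-other p≢z x≢z = trans (apply-swap _) (cong (apply r) (transpose-other (p≢z ∘ sym) (x≢z ∘ sym)))

  module _ (rₚ≡x : apply r p ≡ just x) where

    infiniteOrbit-swap⁺ : ∀ {i} → InfiniteOrbit r i → InfiniteOrbit (swap r p x) i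
    infiniteOrbit-swap⁺ = infiniteOrbit-closed (swap r p x) (InfiniteOrbit r) step
      where
      step : ∀ {z} → InfiniteOrbit r z → ∃[ w ] apply (swap r p x) z ≡ just w × InfiniteOrbit r w
      step {z} orbit with p ≟ᶠ z | x ≟ᶠ z
      ... | yes refl | _ with infiniteOrbit-step r orbit
      ...   | y , rₚ≡y , orbitʸ
        with infiniteOrbit-step r (subst (InfiniteOrbit r) (just-injective (trans (sym rₚ≡y) rₚ≡x)) orbitʸ)
      ...     | w , rₓ≡w , orbitʷ = w , trans apply-swap-first rₓ≡w , orbitʷ
      step orbit | no _ | yes refl = x , trans apply-swap-second rₚ≡x , orbit
      step orbit | no p≢z | no x≢z with infiniteOrbit-step r orbit
      ...   | w , r≡w , orbitʷ = w , trans (apply-swap-other p≢z x≢z) r≡w , orbitʷ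

    infiniteOrbit-swap⁻ : InfiniteOrbit (swap r p x) p → ∀ {i} → InfiniteOrbit (swap r p x) i → InfiniteOrbit r i
    infiniteOrbit-swap⁻ orbitᵖ = infiniteOrbit-closed r (InfiniteOrbit (swap r p x)) step
      where
      step : ∀ {z} → InfiniteOrbit (swap r p x) z → ∃[ w ] apply r z ≡ just w × InfiniteOrbit (swap r p x) w
      step {z} orbit with p ≟ᶠ z | x ≟ᶠ z
      ... | yes refl | _ = x , rₚ≡x , fixed⇒infiniteOrbit (swap r p x) (trans apply-swap-second rₚ≡x)
      ... | no _ | yes refl with infiniteOrbit-step (swap r p x) orbitᵖ
      ...   | w , r′ₚ≡w , orbitʷ = w , trans (sym apply-swap-first) r′ₚ≡w , orbitʷ
      step orbit | no p≢z | no x≢z with infiniteOrbit-step (swap r p x) orbit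
      ...   | w , r′≡w , orbitʷ = w , trans (sym (apply-swap-other p≢z x≢z)) r′≡w , orbitʷ

module _ (r : Word n) (p x : Fin n) (inj : LetterInjective r) (rₚ≡x : apply r p ≡ just x) where

  inCycle-swap⁺ : ∀ {i} → InCycle r i → InCycle (swap r p x) i
  inCycle-swap⁺ =
    infiniteOrbit⇒inCycle _ (swap-letterInjective r p x inj) ∘ infiniteOrbit-swap⁺ r p x rₚ≡x ∘ inCycle⇒infiniteOrbit r

  inCycle-swap : InCycle (swap r p x) p → ∀ i → InCycle r i ⇔ InCycle (swap r p x) i
  inCycle-swap cycleᵖ i = mk⇔ inCycle-swap⁺
    (infiniteOrbit⇒inCycle r inj ∘ infiniteOrbit-swap⁻ r p x rₚ≡x (inCycle⇒infiniteOrbit _ cycleᵖ) ∘ inCycle⇒infiniteOrbit _)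

-- The size of the cycle support

cyclePoints : Word n → List (Fin n)
cyclePoints {n} r = filter (inCycle? r) (allFin n)

fixedPoints : Word n → List (Fin n)
fixedPoints {n} r = filter (λ x → lookup r x ≟ᶠ suc x) (allFin n)

∈-cyclePoints⁻ : {r : Word n} {i : Fin n} → i ∈ cyclePoints r → InCycle r i
∈-cyclePoints⁻ {n} {r} i∈ = proj₂ (∈-filter⁻ (inCycle? r) {xs = allFin n} i∈)

∈-cyclePoints⁺ : {r : Word n} {i : Fin n} → InCycle r i → i ∈ cyclePoints r
∈-cyclePoints⁺ {r = r} {i} = ∈-filter⁺ (inCycle? r) (∈-allFin i)

∈-fixedPoints⁻ : {r : Word n} {x : Fin n} → x ∈ fixedPoints r → lookup r x ≡ suc x
∈-fixedPoints⁻ {n} {r} x∈ = proj₂ (∈-filter⁻ (λ x → lookup r x ≟ᶠ suc x) {xs = allFin n} x∈)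

∈-fixedPoints⁺ : {r : Word n} {x : Fin n} → lookup r x ≡ suc x → x ∈ fixedPoints r
∈-fixedPoints⁺ {r = r} {x} = ∈-filter⁺ (λ x → lookup r x ≟ᶠ suc x) (∈-allFin x)

cycSupportSize-cong : (r r′ : Word n) → (∀ i → InCycle r i ⇔ InCycle r′ i) → cycSupportSize r ≡ cycSupportSize r′
cycSupportSize-cong {n} r r′ same =
  cong length (List.filter-≐ (inCycle? r) (inCycle? r′) (Equivalence.to (same _) , Equivalence.from (same _)) (allFin n))

module _ (n k : ℕ) where

  private
    N : ℕ
    N = suc n

    Rooks : List (Word N)
    Rooks = fibre cycSupportSize (rooks N) (suc k)

    Pointed : List (Word N × Fin N)
    Pointed = sigmaList Rooks cyclePoints

    Fixed : List (Word N × Fin N)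
    Fixed = sigmaList Rooks fixedPoints

    FixedPointed : List ((Word N × Fin N) × Fin N)
    FixedPointed = sigmaList Fixed (cyclePoints ∘ proj₁)

    Smaller : List (Fin N × Word n)
    Smaller = sigmaList (allFin N) (λ _ → fibre cycSupportSize (rooks n) k)

    cyclePoints-unique : (r : Word N) → Unique (cyclePoints r)
    cyclePoints-unique r = Unique.filter⁺ (inCycle? r) (Unique.allFin⁺ N)

    Rooks-unique : Unique Rooks
    Rooks-unique = rookFibre-unique cycSupportSize (suc k)

    Fixed-unique : Unique Fixed
    Fixed-unique = sigmaList-unique Rooks-unique λ r → Unique.filter⁺ (λ x → lookup r x ≟ᶠ suc x) (Unique.allFin⁺ N)

    Pointed≡FixedPointed : length Pointed ≡ length FixedPointed
    Pointed≡FixedPointed = length-≡-inverses makeFixed unmakeFixed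
      (sigmaList-unique Rooks-unique cyclePoints-unique) (sigmaList-unique Fixed-unique (cyclePoints-unique ∘ proj₁))
      makeFixed∈ unmakeFixed∈ (λ { {r , p} _ → cong (_, p) (swap-involutive r p (image r p)) }) unmake-make
      where
      makeFixed : Word N × Fin N → (Word N × Fin N) × Fin N
      makeFixed (r , p) = (swap r p (image r p) , image r p) , p
      unmakeFixed : (Word N × Fin N) × Fin N → Word N × Fin N
      unmakeFixed ((r , x) , s) = swap r s x , s

      makeFixed∈ : ∀ {rp} → rp ∈ Pointed → makeFixed rp ∈ FixedPointed
      makeFixed∈ {r , p} rp∈ with ∈-sigmaList⁻ {xs = Rooks} rp∈
      ... | r∈ , p∈ with ∈-rookFibre⁻ {r = r} r∈
      ...   | inj , cyc≡ = ∈-sigmaList⁺ (∈-sigmaList⁺ (∈-rookFibre⁺ (swap-letterInjective r p x inj) size) x-fixed)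
                             (∈-cyclePoints⁺ {r = swap r p x} (inCycle-swap⁺ r p x inj rₚ≡x cycleᵖ))
        where
        x : Fin N
        x = image r p
        cycleᵖ : InCycle r p
        cycleᵖ = ∈-cyclePoints⁻ {r = r} p∈
        rₚ≡x : apply r p ≡ just x
        rₚ≡x = inCycle⇒apply≡image r cycleᵖ
        size : cycSupportSize (swap r p x) ≡ suc k
        size = trans (sym (cycSupportSize-cong r (swap r p x)
                 (inCycle-swap r p x inj rₚ≡x (inCycle-swap⁺ r p x inj rₚ≡x cycleᵖ)))) cyc≡
        x-fixed : x ∈ fixedPoints (swap r p x)
        x-fixed = ∈-fixedPoints⁺ {r = swap r p x} (trans (lookup-swap r p x x)
          (trans (cong (lookup r) (transpose-matchʳ {i = p} {x})) (apply≡just⇒lookup r rₚ≡x)))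

      module Unmake {r x s} (rxs∈ : ((r , x) , s) ∈ FixedPointed) where
        rx∈ : (r , x) ∈ Fixed
        rx∈ = proj₁ (∈-sigmaList⁻ {xs = Fixed} rxs∈)
        r∈ : r ∈ Rooks
        r∈ = proj₁ (∈-sigmaList⁻ {xs = Rooks} rx∈)
        inj : LetterInjective r
        inj = proj₁ (∈-rookFibre⁻ {r = r} r∈)
        r′ : Word N
        r′ = swap r s x
        r′ₛ≡x : apply r′ s ≡ just x
        r′ₛ≡x = trans (apply-swap-first r s x)
          (lookup≡suc⇒apply r (∈-fixedPoints⁻ {r = r} (proj₂ (∈-sigmaList⁻ {xs = Rooks} rx∈))))
        same : ∀ i → InCycle r′ i ⇔ InCycle r i
        same = subst (λ w → ∀ i → InCycle r′ i ⇔ InCycle w i) (swap-involutive r s x)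
          (inCycle-swap r′ s x (swap-letterInjective r s x inj) r′ₛ≡x
            (subst (λ w → InCycle w s) (sym (swap-involutive r s x))
              (∈-cyclePoints⁻ {r = r} (proj₂ (∈-sigmaList⁻ {xs = Fixed} rxs∈)))))

      unmakeFixed∈ : ∀ {rxs} → rxs ∈ FixedPointed → unmakeFixed rxs ∈ Pointed
      unmakeFixed∈ {(r , x) , s} rxs∈ = ∈-sigmaList⁺
        (∈-rookFibre⁺ (swap-letterInjective r s x inj) (trans (cycSupportSize-cong r′ r same) (proj₂ (∈-rookFibre⁻ {r = r} r∈))))
        (∈-cyclePoints⁺ {r = r′} (Equivalence.from (same s) (∈-cyclePoints⁻ {r = r} (proj₂ (∈-sigmaList⁻ {xs = Fixed} rxs∈)))))
        where open Unmake rxs∈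

      unmake-make : ∀ {rxs} → rxs ∈ FixedPointed → makeFixed (unmakeFixed rxs) ≡ rxs
      unmake-make {(r , x) , s} rxs∈ =
        trans (cong (λ y → (swap r′ s y , y) , s) (apply≡just⇒image r′ {s} r′ₛ≡x))
              (cong (λ w → (w , x) , s) (swap-involutive r s x))
        where open Unmake rxs∈

    Fixed≡Smaller : length Fixed ≡ length Smaller
    Fixed≡Smaller = length-≡-inverses removeFixed insertFixed Fixed-unique
      (sigmaList-unique (Unique.allFin⁺ N) (λ _ → rookFibre-unique cycSupportSize k))
      removeFixed∈ insertFixed∈ insert-remove (λ { {x , r} _ → cong (x ,_) (removeLetter-insertLetter x x r) })
      where
      removeFixed : Word N × Fin N → Fin N × Word n
      removeFixed (r , x) = x , removeLetter x x r
      insertFixed : Fin N × Word n → Word N × Fin N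
      insertFixed (x , r) = insertLetter x x r , x

      module Remove {r x} (rx∈ : (r , x) ∈ Fixed) where
        r∈ : r ∈ Rooks
        r∈ = proj₁ (∈-sigmaList⁻ {xs = Rooks} rx∈)
        inj : LetterInjective r
        inj = proj₁ (∈-rookFibre⁻ {r = r} r∈)
        rₓ≡x : lookup r x ≡ suc x
        rₓ≡x = ∈-fixedPoints⁻ {r = r} (proj₂ (∈-sigmaList⁻ {xs = Rooks} rx∈))

      removeFixed∈ : ∀ {rx} → rx ∈ Fixed → removeFixed rx ∈ Smaller
      removeFixed∈ {r , x} rx∈ = ∈-sigmaList⁺ (∈-allFin x) (∈-rookFibre⁺ inj′ size)
        where
        open Remove rx∈
        inj′ : LetterInjective (removeLetter x x r)
        inj′ = removeLetter-letterInjective x x {r} inj rₓ≡x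
        size : cycSupportSize (removeLetter x x r) ≡ k
        size = suc-injective (begin
          suc (cycSupportSize (removeLetter x x r))              ≡⟨ cycSupportSize-insertFixed x _ inj′ ⟨
          cycSupportSize (insertLetter x x (removeLetter x x r)) ≡⟨ cong cycSupportSize (insertLetter-removeLetter x x {r} inj rₓ≡x) ⟩
          cycSupportSize r                                       ≡⟨ proj₂ (∈-rookFibre⁻ {r = r} r∈) ⟩
          suc k                                                  ∎)
          where open ≡-Reasoning

      insertFixed∈ : ∀ {xr} → xr ∈ Smaller → insertFixed xr ∈ Fixed
      insertFixed∈ {x , r} xr∈ with ∈-rookFibre⁻ {r = r} (proj₂ (∈-sigmaList⁻ {xs = allFin N} xr∈))
      ... | inj , size = ∈-sigmaList⁺
        (∈-rookFibre⁺ (insertLetter-letterInjective x x {r} inj) (trans (cycSupportSize-insertFixed x r inj) (cong suc size)))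
        (∈-fixedPoints⁺ {r = insertLetter x x r} (lookup-insertLetter-at x x r))

      insert-remove : ∀ {rx} → rx ∈ Fixed → insertFixed (removeFixed rx) ≡ rx
      insert-remove {r , x} rx∈ = cong (_, x) (insertLetter-removeLetter x x {r} inj rₓ≡x)
        where open Remove rx∈

    Rooks≡Fixed : length Rooks ≡ length Fixed
    Rooks≡Fixed = *-cancelʳ-≡ (length Rooks) (length Fixed) (suc k) (begin
      length Rooks * suc k ≡⟨ length-sigmaList Rooks cyclePoints (suc k) (λ {r} r∈ → proj₂ (∈-rookFibre⁻ {r = r} r∈)) ⟨
      length Pointed       ≡⟨ Pointed≡FixedPointed ⟩
      length FixedPointed  ≡⟨ length-sigmaList Fixed (cyclePoints ∘ proj₁) (suc k)
                                (λ {(r , _)} rx∈ → proj₂ (∈-rookFibre⁻ {r = r} (proj₁ (∈-sigmaList⁻ {xs = Rooks} rx∈)))) ⟩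
      length Fixed * suc k ∎)
      where open ≡-Reasoning

  countCyc-suc : countCyc (suc n) (suc k) ≡ suc n * countCyc n k
  countCyc-suc = begin
    length Rooks                     ≡⟨ Rooks≡Fixed ⟩
    length Fixed                     ≡⟨ Fixed≡Smaller ⟩
    length Smaller                   ≡⟨ length-sigmaList (allFin N) (λ _ → fibre cycSupportSize (rooks n) k)
                                                         (countCyc n k) (λ _ → refl) ⟩
    length (allFin N) * countCyc n k ≡⟨ cong (_* countCyc n k) (length-allFin N) ⟩
    suc n * countCyc n k             ∎
    where open ≡-Reasoning

PZ≤length : (v : Vec (Fin (suc n)) m) → PZ v ≤ m
PZ≤length []          = z≤n
PZ≤length (zero ∷ v)  = z≤n
PZ≤length (suc _ ∷ v) = s≤s (PZ≤length v)

cycSupportSize≤n : (r : Word n) → cycSupportSize r ≤ n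
cycSupportSize≤n {n} r = subst (cycSupportSize r ≤_) (length-allFin n) (List.length-filter (inCycle? r) (allFin n))

sumUpTo-countCyc≡sumUpTo-countPZ : ∀ n → sumUpTo (countCyc n) n ≡ sumUpTo (countPZ n) n
sumUpTo-countCyc≡sumUpTo-countPZ n =
  trans (sumUpTo-fibreSize cycSupportSize n cycSupportSize≤n (rooks n))
        (sym (sumUpTo-fibreSize PZ n PZ≤length (rooks n)))

countCyc≡countPZ-suc : (∀ k → k ≤ n → countCyc n k ≡ countPZ n k) →
  ∀ k → k ≤ n → countCyc (suc n) (suc k) ≡ countPZ (suc n) (suc k)
countCyc≡countPZ-suc {n} ih k k≤n = begin
  countCyc (suc n) (suc k) ≡⟨ countCyc-suc n k ⟩
  suc n * countCyc n k     ≡⟨ cong (suc n *_) (ih k k≤n) ⟩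
  suc n * countPZ n k      ≡⟨ countPZ-suc n k ⟨
  countPZ (suc n) (suc k)  ∎
  where open ≡-Reasoning

proposition3p31 : (n k : ℕ) → k ≤ n → countCyc n k ≡ countPZ n k
proposition3p31 zero    zero    _         = sumUpTo-countCyc≡sumUpTo-countPZ 0
proposition3p31 (suc n) zero    _         =
  sumUpTo-head (countCyc (suc n)) (countPZ (suc n)) n
    (sumUpTo-countCyc≡sumUpTo-countPZ (suc n)) (countCyc≡countPZ-suc (proposition3p31 n))
proposition3p31 (suc n) (suc k) (s≤s k≤n) = countCyc≡countPZ-suc (proposition3p31 n) k k≤n
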